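{- For all $n\ge1$, $a_{n,4,012}=\frac{2^{n-5}}{3}\left(n^3+12n^2+29n+6\right)$.
   Context: For a finite integer sequence $(a_1,\dots,a_i)$, $\mathrm{asc}(a_1,\dots,a_i)=|\{j:1\le j<i,\ a_j<a_{j+1}\}|$. For an integer $p\ge1$, a $p$-ascent sequence of length $n\ge1$ is a sequence $(a_1,\dots,a_n)$ of nonnegative integers with $a_1=0$ and $a_i\le p+\mathrm{asc}(a_1,\dots,a_{i-1})$ for all $2\le i\le n$. A sequence $w=w_1\dots w_n$ avoids the pattern $012$ if there are no indices $i<j<k$ with $w_i<w_j<w_k$. $a_{n,p,012}$ is the number of $p$-ascent sequences of length $n$ avoiding $012$. -}

module Defs where

open import Data.Nat using (ℕ; zero; suc; _+_; _*_; _<ᵇ_; _≤ᵇ_; _^_)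
open import Data.Bool using (Bool; true; false; _∧_; _∨_; not; if_then_else_)
open import Data.List using (List; []; _∷_; length; filter; map; concatMap; upTo; _++_; [_])
open import Relation.Nullary.Decidable using (Dec)
open import Data.Bool.Properties using (T?)
open import Data.Bool using (T)

asc : List ℕ → ℕ
asc [] = 0
asc (x ∷ []) = 0
asc (x ∷ y ∷ r) = (if x <ᵇ y then 1 else 0) + asc (y ∷ r)

ascentCond : ℕ → List ℕ → List ℕ → Bool
ascentCond p pre [] = true
ascentCond p pre (x ∷ r) = (x ≤ᵇ p + asc pre) ∧ ascentCond p (pre ++ [ x ]) r

isAscentSeq : ℕ → List ℕ → Bool
isAscentSeq p [] = false
isAscentSeq p (zero ∷ r) = ascentCond p [ zero ] r
isAscentSeq p (suc _ ∷ r) = false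

anyGreater : ℕ → List ℕ → Bool
anyGreater x [] = false
anyGreater x (y ∷ r) = (x <ᵇ y) ∨ anyGreater x r

has12After : ℕ → List ℕ → Bool
has12After x [] = false
has12After x (y ∷ r) = ((x <ᵇ y) ∧ anyGreater y r) ∨ has12After x r

contains012 : List ℕ → Bool
contains012 [] = false
contains012 (x ∷ r) = has12After x r ∨ contains012 r

avoids012 : List ℕ → Bool
avoids012 w = not (contains012 w)

allSeqs : ℕ → ℕ → List (List ℕ)
allSeqs m zero = [] ∷ []
allSeqs m (suc n) = concatMap (λ x → map (x ∷_) (allSeqs m n)) (upTo m)

-- a_{n,p,012}. Every p-ascent sequence of length n has entries ≤ p + n,
-- so enumerating entries in {0,…,p+n} captures them all.
a012 : ℕ → ℕ → ℕ
a012 n p = length (filter (λ w → T? (isAscentSeq p w ∧ avoids012 w)) (allSeqs (suc (p + n)) n))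

module Submission where

-- A p-ascent sequence begins with 0, so it avoids 012 exactly when its nonzero
-- entries weakly decrease. Before the first nonzero entry there are no ascents,
-- so the growth condition then only says that every entry is at most p.
-- Let D_c(N) count the words of length N over {0,…,c} with weakly decreasing
-- nonzero letters; splitting on the first letter gives
-- D_c(N+1) = D_c(N) + D_1(N) + … + D_c(N), from which D_1, …, D_4 are computed
-- by induction, and a_{n,4,012} = D_4(n−1).

open import Defs
open import Data.Nat using (ℕ; _+_; _*_; _^_; _≥_)
open import Relation.Binary.PropositionalEquality using (_≡_)

open import Data.Nat using (zero; suc; _<ᵇ_; _≤ᵇ_; _≤_; _<_; s≤s; z≤n)
open import Data.Nat.Properties using (<ᵇ-reflects-<; ≤ᵇ-reflects-≤; ≤-trans; ≤-<-trans; <-trans; n<1+n; m≤m+n; +-identityʳ; *-assoc)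
open import Data.Bool using (Bool; true; false; _∧_; _∨_; not)
open import Data.Bool.Properties using (∧-zeroʳ; ∨-zeroʳ; ∨-identityʳ)
open import Data.List using (List; []; _∷_; length; map; concatMap; applyUpTo; filterᵇ; replicate; _++_; [_])
open import Data.List.Properties using (length-++; filter-++)
open import Data.List.Relation.Unary.All as All using (All; []; _∷_)
open import Relation.Nullary.Reflects using (ofʸ; ofⁿ)
open import Relation.Nullary.Negation using (contradiction)
open import Relation.Binary.PropositionalEquality using (refl; trans; cong; cong₂; subst; module ≡-Reasoning)
open import Data.Nat.Tactic.RingSolver using (solve-∀)

open ≡-Reasoning

<ᵇ-true : ∀ {m n} → m < n → (m <ᵇ n) ≡ true
<ᵇ-true (s≤s z≤n) = refl
<ᵇ-true (s≤s (s≤s m<n)) = <ᵇ-true (s≤s m<n)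

<ᵇ-false : ∀ {m n} → n ≤ m → (m <ᵇ n) ≡ false
<ᵇ-false z≤n = refl
<ᵇ-false (s≤s n≤m) = <ᵇ-false n≤m

<ᵇ-suc : ∀ m n → (m <ᵇ suc n) ≡ not (n <ᵇ m)
<ᵇ-suc zero n = refl
<ᵇ-suc (suc m) zero = refl
<ᵇ-suc (suc m) (suc n) = <ᵇ-suc m n

∨-trueʳ : ∀ {a b} → b ≡ true → a ∨ b ≡ true
∨-trueʳ {a} refl = ∨-zeroʳ a

∨-absorb-implied : ∀ {a b} c → (a ≡ true → b ≡ true) → a ∨ (b ∨ c) ≡ b ∨ c
∨-absorb-implied {false} c _ = refl
∨-absorb-implied {true} c a⇒b rewrite a⇒b refl = refl

replicate-∷ʳ : ∀ {A : Set} n (x : A) → replicate n x ++ [ x ] ≡ replicate (suc n) x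
replicate-∷ʳ zero x = refl
replicate-∷ʳ (suc n) x = cong (x ∷_) (replicate-∷ʳ n x)

asc-replicate-0 : ∀ n → asc (replicate n 0) ≡ 0
asc-replicate-0 zero = refl
asc-replicate-0 (suc zero) = refl
asc-replicate-0 (suc (suc n)) = asc-replicate-0 (suc n)

countᵇ : ∀ {A : Set} → (A → Bool) → List A → ℕ
countᵇ b xs = length (filterᵇ b xs)

module _ {A : Set} where

  countᵇ-++ : ∀ (b : A → Bool) xs ys → countᵇ b (xs ++ ys) ≡ countᵇ b xs + countᵇ b ys
  countᵇ-++ b xs ys = trans (cong length (filter-++ _ xs ys)) (length-++ (filterᵇ b xs))

  countᵇ-cong : ∀ {b b′ : A → Bool} → (∀ x → b x ≡ b′ x) → ∀ xs → countᵇ b xs ≡ countᵇ b′ xs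
  countᵇ-cong eq [] = refl
  countᵇ-cong {b′ = b′} eq (x ∷ xs) rewrite eq x with b′ x
  ... | true = cong suc (countᵇ-cong eq xs)
  ... | false = countᵇ-cong eq xs

  countᵇ-none : ∀ {b : A → Bool} → (∀ x → b x ≡ false) → ∀ xs → countᵇ b xs ≡ 0
  countᵇ-none none [] = refl
  countᵇ-none none (x ∷ xs) rewrite none x = countᵇ-none none xs

  countᵇ-map : ∀ {B : Set} (b : A → Bool) (f : B → A) xs → countᵇ b (map f xs) ≡ countᵇ (λ x → b (f x)) xs
  countᵇ-map b f [] = refl
  countᵇ-map b f (x ∷ xs) with b (f x)
  ... | true = cong suc (countᵇ-map b f xs)
  ... | false = countᵇ-map b f xs

∑< : ℕ → (ℕ → ℕ) → ℕ
∑< zero f = 0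
∑< (suc n) f = f 0 + ∑< n (λ i → f (suc i))

∑<-cong : ∀ {f g} n → (∀ i → i < n → f i ≡ g i) → ∑< n f ≡ ∑< n g
∑<-cong zero eq = refl
∑<-cong (suc n) eq = cong₂ _+_ (eq 0 (s≤s z≤n)) (∑<-cong n (λ i i<n → eq (suc i) (s≤s i<n)))

∑<-zeros : ∀ {f} n → (∀ i → f i ≡ 0) → ∑< n f ≡ 0
∑<-zeros zero _ = refl
∑<-zeros (suc n) f≡0 = cong₂ _+_ (f≡0 0) (∑<-zeros n (λ i → f≡0 (suc i)))

∑<-vanishing : ∀ {f} c n → c ≤ n → (∀ i → c ≤ i → f i ≡ 0) → ∑< n f ≡ ∑< c f
∑<-vanishing zero n _ f≡0 = ∑<-zeros n (λ i → f≡0 i z≤n)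
∑<-vanishing {f} (suc c) (suc n) (s≤s c≤n) f≡0 =
  cong (f 0 +_) (∑<-vanishing c n c≤n (λ i c≤i → f≡0 (suc i) (s≤s c≤i)))

countᵇ-allSeqs-suc : ∀ (b : List ℕ → Bool) m N →
  countᵇ b (allSeqs m (suc N)) ≡ ∑< m (λ x → countᵇ (λ w → b (x ∷ w)) (allSeqs m N))
countᵇ-allSeqs-suc b m N = go (λ x → x) m
  where
  L = allSeqs m N
  go : ∀ h n → countᵇ b (concatMap (λ x → map (x ∷_) L) (applyUpTo h n))
             ≡ ∑< n (λ i → countᵇ (λ w → b (h i ∷ w)) L)
  go h zero = refl
  go h (suc n) =
    trans (countᵇ-++ b (map (h 0 ∷_) L) _) (cong₂ _+_ (countᵇ-map b (h 0 ∷_) L) (go (λ i → h (suc i)) n))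

nonzeroDescending : ℕ → List ℕ → Bool
nonzeroDescending c [] = true
nonzeroDescending c (zero ∷ w) = nonzeroDescending c w
nonzeroDescending c (suc x ∷ w) = (x <ᵇ c) ∧ nonzeroDescending (suc x) w

nonzeroDescending⇒bounded : ∀ {c} r → nonzeroDescending c r ≡ true → All (_≤ c) r
nonzeroDescending⇒bounded [] _ = []
nonzeroDescending⇒bounded (zero ∷ r) h = z≤n ∷ nonzeroDescending⇒bounded r h
nonzeroDescending⇒bounded {c} (suc x ∷ r) h with x <ᵇ c | <ᵇ-reflects-< x c | h
... | true | ofʸ x<c | h′ = x<c ∷ All.map (λ y≤ → ≤-trans y≤ x<c) (nonzeroDescending⇒bounded r h′)

anyGreater-antitone : ∀ {x c} r → x ≤ c → anyGreater c r ≡ true → anyGreater x r ≡ true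
anyGreater-antitone {x} {c} (y ∷ r) x≤c h with x <ᵇ y | <ᵇ-reflects-< x y | c <ᵇ y | <ᵇ-reflects-< c y
... | true | _ | _ | _ = refl
... | false | ofⁿ x≮y | true | ofʸ c<y = contradiction (≤-<-trans x≤c c<y) x≮y
... | false | _ | false | _ = anyGreater-antitone r x≤c h

has12After⇒has12After₀ : ∀ x r → has12After x r ≡ true → has12After 0 r ≡ true
has12After⇒has12After₀ x (zero ∷ r) h = has12After⇒has12After₀ x r h
has12After⇒has12After₀ x (suc y ∷ r) h with anyGreater (suc y) r
... | true = refl
... | false = has12After⇒has12After₀ x r (subst (λ a → a ∨ has12After x r ≡ true) (∧-zeroʳ _) h)

contains012⇒has12After₀ : ∀ r → contains012 r ≡ true → has12After 0 r ≡ true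
contains012⇒has12After₀ (x ∷ r) h with has12After x r in e
... | true = ∨-trueʳ (has12After⇒has12After₀ x r e)
... | false = ∨-trueʳ (contains012⇒has12After₀ r h)

avoids012-0∷ : ∀ r → avoids012 (0 ∷ r) ≡ not (has12After 0 r)
avoids012-0∷ r with contains012 r in e
... | false = cong not (∨-identityʳ _)
... | true rewrite contains012⇒has12After₀ r e = refl

nonzeroDescending-spec : ∀ c r → not (anyGreater c r ∨ has12After 0 r) ≡ nonzeroDescending c r
nonzeroDescending-spec c [] = refl
nonzeroDescending-spec c (zero ∷ r) = nonzeroDescending-spec c r
nonzeroDescending-spec c (suc y ∷ r) rewrite <ᵇ-suc c y with y <ᵇ c | <ᵇ-reflects-< y c
... | false | _ = refl
... | true | ofʸ y<c =
  trans (cong not (∨-absorb-implied _ (anyGreater-antitone r y<c))) (nonzeroDescending-spec (suc y) r)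

ascentCond-bounded : ∀ {p} pre {r} → All (_≤ p) r → ascentCond p pre r ≡ true
ascentCond-bounded pre [] = refl
ascentCond-bounded {p} pre {x ∷ _} (x≤p ∷ rest) with x ≤ᵇ p + asc pre | ≤ᵇ-reflects-≤ x (p + asc pre)
... | true | _ = ascentCond-bounded (pre ++ [ x ]) rest
... | false | ofⁿ x≰ = contradiction (≤-trans x≤p (m≤m+n p (asc pre))) x≰

ascentCond-zeros : ∀ p k r →
  ascentCond p (replicate (suc k) 0) r ∧ not (has12After 0 r) ≡ nonzeroDescending p r
ascentCond-zeros p k [] = refl
ascentCond-zeros p k (zero ∷ r) rewrite replicate-∷ʳ k 0 = ascentCond-zeros p (suc k) r
ascentCond-zeros p k (suc x ∷ r)
  rewrite asc-replicate-0 (suc k) | +-identityʳ p | nonzeroDescending-spec (suc x) r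
  with x <ᵇ p | <ᵇ-reflects-< x p
... | false | _ = refl
... | true | ofʸ x<p with nonzeroDescending (suc x) r in desc
...   | false = ∧-zeroʳ _
...   | true rewrite ascentCond-bounded (replicate (suc k) 0 ++ [ suc x ])
                       (All.map (λ y≤ → ≤-trans y≤ x<p) (nonzeroDescending⇒bounded r desc)) = refl

ascentAvoider-0∷ : ∀ p r → isAscentSeq p (0 ∷ r) ∧ avoids012 (0 ∷ r) ≡ nonzeroDescending p r
ascentAvoider-0∷ p r rewrite avoids012-0∷ r = ascentCond-zeros p 0 r

-- Words of length N over {0,…,m−1}; the count does not depend on m as long as c < m.
countDescending : ℕ → ℕ → ℕ → ℕ
countDescending m c N = countᵇ (nonzeroDescending c) (allSeqs m N)

a012≡countDescending : ∀ p N → a012 (suc N) p ≡ countDescending (suc (p + suc N)) p N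
a012≡countDescending p N = begin
  a012 (suc N) p
    ≡⟨ countᵇ-allSeqs-suc ascentAvoider m N ⟩
  countᵇ (λ w → ascentAvoider (0 ∷ w)) L + ∑< (p + suc N) (λ x → countᵇ (λ w → ascentAvoider (suc x ∷ w)) L)
    ≡⟨ cong₂ _+_ (countᵇ-cong (ascentAvoider-0∷ p) L) (∑<-zeros (p + suc N) (λ _ → countᵇ-none (λ _ → refl) L)) ⟩
  countDescending m p N + 0
    ≡⟨ +-identityʳ _ ⟩
  countDescending m p N ∎
  where
  m = suc (p + suc N)
  L = allSeqs m N
  ascentAvoider : List ℕ → Bool
  ascentAvoider w = isAscentSeq p w ∧ avoids012 w

countDescending-suc : ∀ {m c} → c < m → ∀ N →
  countDescending m c (suc N) ≡ countDescending m c N + ∑< c (λ y → countDescending m (suc y) N)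
countDescending-suc {m} {c} c<m N = begin
  countDescending m c (suc N)
    ≡⟨ countᵇ-allSeqs-suc (nonzeroDescending c) m N ⟩
  ∑< m firstEntry
    ≡⟨ ∑<-vanishing (suc c) m c<m firstEntry-vanishes ⟩
  countDescending m c N + ∑< c (λ y → firstEntry (suc y))
    ≡⟨ cong (countDescending m c N +_) (∑<-cong c (λ y y<c →
         cong (λ t → countᵇ (λ w → t ∧ nonzeroDescending (suc y) w) L) (<ᵇ-true y<c))) ⟩
  countDescending m c N + ∑< c (λ y → countDescending m (suc y) N) ∎
  where
  L = allSeqs m N
  firstEntry : ℕ → ℕ
  firstEntry x = countᵇ (λ w → nonzeroDescending c (x ∷ w)) L
  firstEntry-vanishes : ∀ x → suc c ≤ x → firstEntry x ≡ 0
  firstEntry-vanishes (suc y) (s≤s c≤y) = countᵇ-none (λ w → cong (_∧ nonzeroDescending (suc y) w) (<ᵇ-false c≤y)) L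

countDescending-1 : ∀ {m} → 1 < m → ∀ N → countDescending m 1 N ≡ 2 ^ N
countDescending-1 m>1 zero = refl
countDescending-1 m>1 (suc N) =
  trans (countDescending-suc m>1 N) (cong (λ d → d + (d + 0)) (countDescending-1 m>1 N))

countDescending-2 : ∀ {m} → 2 < m → ∀ N → 2 * countDescending m 2 N ≡ 2 ^ N * (N + 2)
countDescending-2 m>2 zero = refl
countDescending-2 {m} m>2 (suc N) = begin
  2 * countDescending m 2 (suc N)        ≡⟨ cong (2 *_) (countDescending-suc m>2 N) ⟩
  2 * (d₂ + (d₁ + (d₂ + 0)))             ≡⟨ regroup d₁ d₂ ⟩
  2 * d₁ + 2 * (2 * d₂)                  ≡⟨ cong₂ (λ a b → 2 * a + 2 * b) (countDescending-1 m>1 N) (countDescending-2 m>2 N) ⟩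
  2 * t + 2 * (t * (N + 2))              ≡⟨ expand t N ⟩
  2 * t * (suc N + 2)                    ∎
  where
  m>1 = <-trans (n<1+n 1) m>2
  d₁ = countDescending m 1 N
  d₂ = countDescending m 2 N
  t = 2 ^ N
  regroup : ∀ d₁ d₂ → 2 * (d₂ + (d₁ + (d₂ + 0))) ≡ 2 * d₁ + 2 * (2 * d₂)
  regroup = solve-∀
  expand : ∀ t N → 2 * t + 2 * (t * (N + 2)) ≡ 2 * t * (suc N + 2)
  expand = solve-∀

countDescending-3 : ∀ {m} → 3 < m → ∀ N → 8 * countDescending m 3 N ≡ 2 ^ N * (N * N + 7 * N + 8)
countDescending-3 m>3 zero = refl
countDescending-3 {m} m>3 (suc N) = begin
  8 * countDescending m 3 (suc N)        ≡⟨ cong (8 *_) (countDescending-suc m>3 N) ⟩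
  8 * (d₃ + (d₁ + (d₂ + (d₃ + 0))))      ≡⟨ regroup d₁ d₂ d₃ ⟩
  8 * d₁ + 4 * (2 * d₂) + 2 * (8 * d₃)   ≡⟨ cong₂ _+_ (cong₂ (λ a b → 8 * a + 4 * b) (countDescending-1 m>1 N) (countDescending-2 m>2 N))
                                                      (cong (2 *_) (countDescending-3 m>3 N)) ⟩
  8 * t + 4 * (t * (N + 2)) + 2 * (t * (N * N + 7 * N + 8))
                                         ≡⟨ expand t N ⟩
  2 * t * (suc N * suc N + 7 * suc N + 8) ∎
  where
  m>2 = <-trans (n<1+n 2) m>3
  m>1 = <-trans (n<1+n 1) m>2
  d₁ = countDescending m 1 N
  d₂ = countDescending m 2 N
  d₃ = countDescending m 3 N
  t = 2 ^ N
  regroup : ∀ d₁ d₂ d₃ → 8 * (d₃ + (d₁ + (d₂ + (d₃ + 0)))) ≡ 8 * d₁ + 4 * (2 * d₂) + 2 * (8 * d₃)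
  regroup = solve-∀
  expand : ∀ t N → 8 * t + 4 * (t * (N + 2)) + 2 * (t * (N * N + 7 * N + 8))
                 ≡ 2 * t * (suc N * suc N + 7 * suc N + 8)
  expand = solve-∀

countDescending-4 : ∀ {m} → 4 < m → ∀ N →
  48 * countDescending m 4 N ≡ 2 ^ N * (N * N * N + 15 * (N * N) + 56 * N + 48)
countDescending-4 m>4 zero = refl
countDescending-4 {m} m>4 (suc N) = begin
  48 * countDescending m 4 (suc N)       ≡⟨ cong (48 *_) (countDescending-suc m>4 N) ⟩
  48 * (d₄ + (d₁ + (d₂ + (d₃ + (d₄ + 0)))))
                                         ≡⟨ regroup d₁ d₂ d₃ d₄ ⟩
  48 * d₁ + 24 * (2 * d₂) + 6 * (8 * d₃) + 2 * (48 * d₄)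
                                         ≡⟨ cong₂ _+_ (cong₂ _+_ (cong₂ (λ a b → 48 * a + 24 * b) (countDescending-1 m>1 N) (countDescending-2 m>2 N))
                                                                 (cong (6 *_) (countDescending-3 m>3 N)))
                                                      (cong (2 *_) (countDescending-4 m>4 N)) ⟩
  48 * t + 24 * (t * (N + 2)) + 6 * (t * (N * N + 7 * N + 8)) + 2 * (t * (N * N * N + 15 * (N * N) + 56 * N + 48))
                                         ≡⟨ expand t N ⟩
  2 * t * (suc N * suc N * suc N + 15 * (suc N * suc N) + 56 * suc N + 48) ∎
  where
  m>3 = <-trans (n<1+n 3) m>4
  m>2 = <-trans (n<1+n 2) m>3
  m>1 = <-trans (n<1+n 1) m>2
  d₁ = countDescending m 1 N
  d₂ = countDescending m 2 N
  d₃ = countDescending m 3 N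
  d₄ = countDescending m 4 N
  t = 2 ^ N
  regroup : ∀ d₁ d₂ d₃ d₄ → 48 * (d₄ + (d₁ + (d₂ + (d₃ + (d₄ + 0)))))
                          ≡ 48 * d₁ + 24 * (2 * d₂) + 6 * (8 * d₃) + 2 * (48 * d₄)
  regroup = solve-∀
  expand : ∀ t N → 48 * t + 24 * (t * (N + 2)) + 6 * (t * (N * N + 7 * N + 8))
                     + 2 * (t * (N * N * N + 15 * (N * N) + 56 * N + 48))
                 ≡ 2 * t * (suc N * suc N * suc N + 15 * (suc N * suc N) + 56 * suc N + 48)
  expand = solve-∀

mainTheorem18 : (n : ℕ) → n ≥ 1 →
    96 * a012 n 4 ≡ 2 ^ n * (n * n * n + 12 * (n * n) + 29 * n + 6)
mainTheorem18 (suc N) _ = begin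
  96 * a012 (suc N) 4                            ≡⟨ cong (96 *_) (a012≡countDescending 4 N) ⟩
  96 * countDescending (6 + N) 4 N               ≡⟨ *-assoc 2 48 (countDescending (6 + N) 4 N) ⟩
  2 * (48 * countDescending (6 + N) 4 N)         ≡⟨ cong (2 *_) (countDescending-4 (s≤s (s≤s (s≤s (s≤s (s≤s z≤n))))) N) ⟩
  2 * (2 ^ N * (N * N * N + 15 * (N * N) + 56 * N + 48))
                                                 ≡⟨ shift (2 ^ N) N ⟩
  2 * 2 ^ N * (suc N * suc N * suc N + 12 * (suc N * suc N) + 29 * suc N + 6) ∎
  where
  shift : ∀ t N → 2 * (t * (N * N * N + 15 * (N * N) + 56 * N + 48))
                ≡ 2 * t * (suc N * suc N * suc N + 12 * (suc N * suc N) + 29 * suc N + 6)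
  shift = solve-∀
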